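{- For every $\mathbf{S}$-forest $[t]$, $K[t]$ is an FTP-forest.
   Context: For relations with disjoint domains: $\langle R,X\rangle+\langle S,Y\rangle=\langle R\cup S,X\cup Y\rangle$, $\langle R,X\rangle\cdot\langle S,Y\rangle=\langle R\cup S\cup(X\times Y),X\cup Y\rangle$. $\mathbf{S}$-terms are built from an infinite set of $\mathbf{S}$-variables with binary $+$ and $\cdot$; $[t]$ is the class of $t$ modulo the least congruence making $+$ associative and commutative and $\cdot$ associative. $t$ is diversified if no variable occurs twice. For diversified $t$: $K[x]=\langle\emptyset,\{x\}\rangle$, $K[t+s]=K[t]+K[s]$, $K[t\cdot s]=K[t]\cdot K[s]$. Let $C$ be the least set of classes with $[x]\in C$ for each variable $x$, $[t+s]\in C$ whenever $[t],[s]\in C$, and $[x\cdot t]\in C$ whenever $[t]\in C$ and $x$ is a variable; an $\mathbf{S}$-forest is a diversified element of $C$. An FTP-forest is a strict (irreflexive, transitive) partial order $\langle R,X\rangle$ with $X$ a finite set of $\mathbf{S}$-variables such that for all $x,y,z\in X$, if $(x,z)\in R$ and $(y,z)\in R$ then $x=y$ or $(x,y)\in R$ or $(y,x)\in R$. -}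

module Defs where

open import Data.Nat using (ℕ)
open import Data.List using (List; []; _∷_; _++_; [_])
open import Data.List.Membership.Propositional using (_∈_)
open import Data.List.Relation.Unary.Unique.Propositional using (Unique)
open import Data.Product using (_×_; Σ; ∃)
open import Data.Sum using (_⊎_)
open import Data.Empty using (⊥)
open import Relation.Binary.PropositionalEquality using (_≡_)
open import Relation.Nullary using (¬_)

Var : Set
Var = ℕ

infixl 6 _⊕_
infixl 7 _⊙_
data Term : Set where
  var : Var → Term
  _⊕_ : Term → Term → Term
  _⊙_ : Term → Term → Term

infix 4 _≈_
data _≈_ : Term → Term → Set where
  ≈-refl  : ∀ {t} → t ≈ t
  ≈-sym   : ∀ {t s} → t ≈ s → s ≈ t
  ≈-trans : ∀ {t s u} → t ≈ s → s ≈ u → t ≈ u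
  ⊕-cong  : ∀ {t t' s s'} → t ≈ t' → s ≈ s' → t ⊕ s ≈ t' ⊕ s'
  ⊙-cong  : ∀ {t t' s s'} → t ≈ t' → s ≈ s' → t ⊙ s ≈ t' ⊙ s'
  ⊕-assoc : ∀ {t s u} → (t ⊕ s) ⊕ u ≈ t ⊕ (s ⊕ u)
  ⊕-comm  : ∀ {t s} → t ⊕ s ≈ s ⊕ t
  ⊙-assoc : ∀ {t s u} → (t ⊙ s) ⊙ u ≈ t ⊙ (s ⊙ u)

vars : Term → List Var
vars (var x) = [ x ]
vars (t ⊕ s) = vars t ++ vars s
vars (t ⊙ s) = vars t ++ vars s

Diversified : Term → Set
Diversified t = Unique (vars t)

-- The set C of classes, represented as the set of terms whose class lies in C:
-- the least set of terms closed under the three generating rules and under ≈.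
data InC : Term → Set where
  c-var  : ∀ x → InC (var x)
  c-plus : ∀ {t s} → InC t → InC s → InC (t ⊕ s)
  c-dot  : ∀ x {t} → InC t → InC (var x ⊙ t)
  c-cong : ∀ {t t'} → InC t → t ≈ t' → InC t'

IsSForest : Term → Set
IsSForest t = InC t × Diversified t

record Rel : Set₁ where
  constructor ⟨_,_⟩
  field
    R : Var → Var → Set
    X : Var → Set
open Rel public

_+ᴿ_ : Rel → Rel → Rel
⟨ R₁ , X₁ ⟩ +ᴿ ⟨ R₂ , X₂ ⟩ = ⟨ (λ a b → R₁ a b ⊎ R₂ a b) , (λ a → X₁ a ⊎ X₂ a) ⟩

_·ᴿ_ : Rel → Rel → Rel
⟨ R₁ , X₁ ⟩ ·ᴿ ⟨ R₂ , X₂ ⟩ =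
  ⟨ (λ a b → (R₁ a b ⊎ R₂ a b) ⊎ (X₁ a × X₂ b)) , (λ a → X₁ a ⊎ X₂ a) ⟩

-- K[t] (the paper applies it to diversified t, where domains are disjoint)
K : Term → Rel
K (var x) = ⟨ (λ _ _ → ⊥) , (λ a → a ≡ x) ⟩
K (t ⊕ s) = K t +ᴿ K s
K (t ⊙ s) = K t ·ᴿ K s

record IsFTPForest (P : Rel) : Set where
  field
    finite     : ∃ λ (xs : List Var) → ∀ a → (X P a → a ∈ xs) × (a ∈ xs → X P a)
    field-⊆    : ∀ a b → R P a b → X P a × X P b
    irreflexive : ∀ a → ¬ R P a a
    transitive : ∀ a b c → R P a b → R P b c → R P a c
    forest     : ∀ x y z → X P x → X P y → X P z →
                 R P x z → R P y z → (x ≡ y) ⊎ (R P x y ⊎ R P y x)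

module Submission where

-- The proof follows the inductive definition of the set C of S-forests.
--   * The two ways of building forests are matched by two constructions on
--     relations that preserve FTP-forests: the disjoint union P + Q of two
--     FTP-forests with disjoint domains, and the "rooted" forest
--     ⟨∅,{v}⟩ · P obtained by putting a fresh variable v below every element
--     of P.  A single point ⟨∅,{x}⟩ is trivially an FTP-forest.
--   * Diversification provides the disjointness these constructions need,
--     since the domain of K[t] consists of variables occurring in t.
--   * Closure of C under the congruence ≈ is handled by showing that
--     ≈-related terms have permuted variable lists (so diversification is
--     invariant) and pointwise equivalent K-relations (so being an
--     FTP-forest is invariant).

open import Defs
open import Data.Nat using (ℕ)
open import Data.List using (List; []; _∷_; _++_; [_])
open import Data.List.Membership.Propositional using (_∈_)
open import Data.List.Membership.Propositional.Properties using (∈-++⁺ˡ; ∈-++⁺ʳ; ∈-++⁻)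
open import Data.List.Relation.Unary.Any using (here; there)
open import Data.List.Relation.Unary.All as All using ()
open import Data.List.Relation.Unary.All.Properties as All using ()
open import Data.List.Relation.Unary.Unique.Propositional using (Unique; []; _∷_)
open import Data.List.Relation.Binary.Disjoint.Propositional using (Disjoint)
open import Data.List.Relation.Binary.Permutation.Propositional
  using (_↭_; ↭-refl; ↭-sym; ↭-trans; ↭-reflexive; ↭⇒↭ₛ)
open import Data.List.Relation.Binary.Permutation.Propositional.Properties using (++⁺; ++-comm)
open import Data.List.Relation.Binary.Permutation.Setoid.Properties using (Unique-resp-↭)
open import Data.List.Properties using (++-assoc)
open import Data.Product as Product using (_×_; _,_; proj₁; proj₂; ∃)
open import Data.Product.Function.NonDependent.Propositional using (_×-⇔_)
open import Data.Sum as Sum using (_⊎_; inj₁; inj₂)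
open import Data.Sum.Function.Propositional using (_⊎-⇔_)
open import Data.Empty using (⊥; ⊥-elim)
open import Function.Bundles using (_⇔_; mk⇔; Equivalence)
open import Function.Construct.Identity using (⇔-id)
open import Function.Construct.Symmetry using (⇔-sym)
open import Function.Construct.Composition using (_⇔-∘_)
open import Relation.Binary.PropositionalEquality using (_≡_; refl; sym; trans; setoid)
open import Relation.Nullary using (¬_)

open Equivalence using (to; from)

-- Two relations are equivalent when they have logically equivalent
-- graphs and domains; this is the equality of relations up to which
-- K respects the congruence ≈.
infix 4 _≅_
record _≅_ (P Q : Rel) : Set where
  field
    R-⇔ : ∀ a b → R P a b ⇔ R Q a b
    X-⇔ : ∀ a → X P a ⇔ X Q a
open _≅_

≅-refl : ∀ {P} → P ≅ P
≅-refl {P} = record { R-⇔ = λ a b → ⇔-id (R P a b) ; X-⇔ = λ a → ⇔-id (X P a) }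

≅-sym : ∀ {P Q} → P ≅ Q → Q ≅ P
≅-sym e = record { R-⇔ = λ a b → ⇔-sym (R-⇔ e a b) ; X-⇔ = λ a → ⇔-sym (X-⇔ e a) }

≅-trans : ∀ {P Q S} → P ≅ Q → Q ≅ S → P ≅ S
≅-trans e f = record
  { R-⇔ = λ a b → R-⇔ f a b ⇔-∘ R-⇔ e a b
  ; X-⇔ = λ a → X-⇔ f a ⇔-∘ X-⇔ e a
  }

+ᴿ-cong : ∀ {P P′ Q Q′} → P ≅ P′ → Q ≅ Q′ → P +ᴿ Q ≅ P′ +ᴿ Q′
+ᴿ-cong e f = record
  { R-⇔ = λ a b → R-⇔ e a b ⊎-⇔ R-⇔ f a b
  ; X-⇔ = λ a → X-⇔ e a ⊎-⇔ X-⇔ f a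
  }

·ᴿ-cong : ∀ {P P′ Q Q′} → P ≅ P′ → Q ≅ Q′ → P ·ᴿ Q ≅ P′ ·ᴿ Q′
·ᴿ-cong e f = record
  { R-⇔ = λ a b → (R-⇔ e a b ⊎-⇔ R-⇔ f a b) ⊎-⇔ (X-⇔ e a ×-⇔ X-⇔ f b)
  ; X-⇔ = λ a → X-⇔ e a ⊎-⇔ X-⇔ f a
  }

+ᴿ-assoc : ∀ P Q S → (P +ᴿ Q) +ᴿ S ≅ P +ᴿ (Q +ᴿ S)
+ᴿ-assoc P Q S = record
  { R-⇔ = λ _ _ → mk⇔ Sum.assocʳ Sum.assocˡ
  ; X-⇔ = λ _ → mk⇔ Sum.assocʳ Sum.assocˡ
  }

+ᴿ-comm : ∀ P Q → P +ᴿ Q ≅ Q +ᴿ P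
+ᴿ-comm P Q = record
  { R-⇔ = λ _ _ → mk⇔ Sum.swap Sum.swap
  ; X-⇔ = λ _ → mk⇔ Sum.swap Sum.swap
  }

-- In (P·Q)·S and P·(Q·S) a pair is related iff it is related in one of
-- P, Q, S or goes from an earlier factor to a later one.
·ᴿ-assoc : ∀ P Q S → (P ·ᴿ Q) ·ᴿ S ≅ P ·ᴿ (Q ·ᴿ S)
·ᴿ-assoc P Q S = record
  { R-⇔ = λ _ _ → mk⇔ regroupʳ regroupˡ
  ; X-⇔ = λ _ → mk⇔ Sum.assocʳ Sum.assocˡ
  }
  where
  regroupʳ : ∀ {Rp Rq Rs Xpa Xqa Xqb Xsb : Set} →
             (((Rp ⊎ Rq) ⊎ (Xpa × Xqb)) ⊎ Rs) ⊎ ((Xpa ⊎ Xqa) × Xsb) →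
             (Rp ⊎ ((Rq ⊎ Rs) ⊎ (Xqa × Xsb))) ⊎ (Xpa × (Xqb ⊎ Xsb))
  regroupʳ (inj₁ (inj₁ (inj₁ (inj₁ r)))) = inj₁ (inj₁ r)
  regroupʳ (inj₁ (inj₁ (inj₁ (inj₂ r)))) = inj₁ (inj₂ (inj₁ (inj₁ r)))
  regroupʳ (inj₁ (inj₁ (inj₂ (x , y))))  = inj₂ (x , inj₁ y)
  regroupʳ (inj₁ (inj₂ r))               = inj₁ (inj₂ (inj₁ (inj₂ r)))
  regroupʳ (inj₂ (inj₁ x , y))           = inj₂ (x , inj₂ y)
  regroupʳ (inj₂ (inj₂ x , y))           = inj₁ (inj₂ (inj₂ (x , y)))

  regroupˡ : ∀ {Rp Rq Rs Xpa Xqa Xqb Xsb : Set} →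
             (Rp ⊎ ((Rq ⊎ Rs) ⊎ (Xqa × Xsb))) ⊎ (Xpa × (Xqb ⊎ Xsb)) →
             (((Rp ⊎ Rq) ⊎ (Xpa × Xqb)) ⊎ Rs) ⊎ ((Xpa ⊎ Xqa) × Xsb)
  regroupˡ (inj₁ (inj₁ r))               = inj₁ (inj₁ (inj₁ (inj₁ r)))
  regroupˡ (inj₁ (inj₂ (inj₁ (inj₁ r)))) = inj₁ (inj₁ (inj₁ (inj₂ r)))
  regroupˡ (inj₁ (inj₂ (inj₁ (inj₂ r)))) = inj₁ (inj₂ r)
  regroupˡ (inj₁ (inj₂ (inj₂ (x , y))))  = inj₂ (inj₂ x , y)
  regroupˡ (inj₂ (x , inj₁ y))           = inj₁ (inj₁ (inj₂ (x , y)))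
  regroupˡ (inj₂ (x , inj₂ y))           = inj₂ (inj₁ x , y)

K-resp-≈ : ∀ {t s} → t ≈ s → K t ≅ K s
K-resp-≈ ≈-refl                  = ≅-refl
K-resp-≈ (≈-sym p)               = ≅-sym (K-resp-≈ p)
K-resp-≈ (≈-trans p q)           = ≅-trans (K-resp-≈ p) (K-resp-≈ q)
K-resp-≈ (⊕-cong p q)            = +ᴿ-cong (K-resp-≈ p) (K-resp-≈ q)
K-resp-≈ (⊙-cong p q)            = ·ᴿ-cong (K-resp-≈ p) (K-resp-≈ q)
K-resp-≈ (⊕-assoc {t} {s} {u})   = +ᴿ-assoc (K t) (K s) (K u)
K-resp-≈ (⊕-comm {t} {s})        = +ᴿ-comm (K t) (K s)
K-resp-≈ (⊙-assoc {t} {s} {u})   = ·ᴿ-assoc (K t) (K s) (K u)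

FTP-resp-≅ : ∀ {P Q} → P ≅ Q → IsFTPForest P → IsFTPForest Q
FTP-resp-≅ {P} {Q} e F = record
  { finite      = xs , λ a → (λ x → proj₁ (enum a) (X← x)) , (λ m → X→ (proj₂ (enum a) m))
  ; field-⊆     = λ a b r → Product.map X→ X→ (F.field-⊆ a b (R← r))
  ; irreflexive = λ a r → F.irreflexive a (R← r)
  ; transitive  = λ a b c r r′ → R→ (F.transitive a b c (R← r) (R← r′))
  ; forest      = λ x y z px py pz r r′ →
      Sum.map₂ (Sum.map R→ R→) (F.forest x y z (X← px) (X← py) (X← pz) (R← r) (R← r′))
  }
  where
  module F = IsFTPForest F
  xs   = proj₁ F.finite
  enum = proj₂ F.finite
  R→ : ∀ {a b} → R P a b → R Q a b
  R→ {a} {b} = to (R-⇔ e a b)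
  R← : ∀ {a b} → R Q a b → R P a b
  R← {a} {b} = from (R-⇔ e a b)
  X→ : ∀ {a} → X P a → X Q a
  X→ {a} = to (X-⇔ e a)
  X← : ∀ {a} → X Q a → X P a
  X← {a} = from (X-⇔ e a)

vars-resp-≈ : ∀ {t s} → t ≈ s → vars t ↭ vars s
vars-resp-≈ ≈-refl                = ↭-refl
vars-resp-≈ (≈-sym p)             = ↭-sym (vars-resp-≈ p)
vars-resp-≈ (≈-trans p q)         = ↭-trans (vars-resp-≈ p) (vars-resp-≈ q)
vars-resp-≈ (⊕-cong p q)          = ++⁺ (vars-resp-≈ p) (vars-resp-≈ q)
vars-resp-≈ (⊙-cong p q)          = ++⁺ (vars-resp-≈ p) (vars-resp-≈ q)
vars-resp-≈ (⊕-assoc {t} {s} {u}) = ↭-reflexive (++-assoc (vars t) (vars s) (vars u))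
vars-resp-≈ (⊕-comm {t} {s})      = ++-comm (vars t) (vars s)
vars-resp-≈ (⊙-assoc {t} {s} {u}) = ↭-reflexive (++-assoc (vars t) (vars s) (vars u))

diversified-resp-≈ : ∀ {t s} → t ≈ s → Diversified t → Diversified s
diversified-resp-≈ p = Unique-resp-↭ (setoid ℕ) (↭⇒↭ₛ (vars-resp-≈ p))

Unique-++⁻ : ∀ {A : Set} (xs : List A) {ys} → Unique (xs ++ ys) →
             Unique xs × Unique ys × Disjoint xs ys
Unique-++⁻ []       u          = [] , u , λ ()
Unique-++⁻ (x ∷ xs) (x∉ ∷ u) with Unique-++⁻ xs u
... | uxs , uys , xs#ys = All.++⁻ˡ xs x∉ ∷ uxs , uys , disjoint
  where
  disjoint : Disjoint (x ∷ xs) _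
  disjoint (here refl , m) = All.lookup (All.++⁻ʳ xs x∉) m refl
  disjoint (there m , m′)  = xs#ys (m , m′)

K-domain⊆vars : ∀ t {a} → X (K t) a → a ∈ vars t
K-domain⊆vars (var x) p        = here p
K-domain⊆vars (t ⊕ s) (inj₁ p) = ∈-++⁺ˡ (K-domain⊆vars t p)
K-domain⊆vars (t ⊕ s) (inj₂ p) = ∈-++⁺ʳ (vars t) (K-domain⊆vars s p)
K-domain⊆vars (t ⊙ s) (inj₁ p) = ∈-++⁺ˡ (K-domain⊆vars t p)
K-domain⊆vars (t ⊙ s) (inj₂ p) = ∈-++⁺ʳ (vars t) (K-domain⊆vars s p)

IsFinite : (Var → Set) → Set
IsFinite A = ∃ λ (xs : List Var) → ∀ a → (A a → a ∈ xs) × (a ∈ xs → A a)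

∪-finite : ∀ {A B} → IsFinite A → IsFinite B → IsFinite (λ a → A a ⊎ B a)
∪-finite (xs , enumA) (ys , enumB) = xs ++ ys , λ a →
  Sum.[ (λ p → ∈-++⁺ˡ (proj₁ (enumA a) p)) , (λ q → ∈-++⁺ʳ xs (proj₁ (enumB a) q)) ] ,
  (λ m → Sum.map (proj₂ (enumA a)) (proj₂ (enumB a)) (∈-++⁻ xs m))

point-FTP : ∀ x → IsFTPForest (K (var x))
point-FTP x = record
  { finite      = [ x ] , λ a → here , λ { (here p) → p }
  ; field-⊆     = λ _ _ ()
  ; irreflexive = λ _ ()
  ; transitive  = λ _ _ _ ()
  ; forest      = λ _ _ _ _ _ _ ()
  }

-- The union of two FTP-forests with disjoint domains is an FTP-forest:
-- related pairs never cross between the components, because each pair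
-- lies in the domain of its own component.
+ᴿ-FTP : ∀ {P Q} → IsFTPForest P → IsFTPForest Q →
         (∀ {a} → X P a → X Q a → ⊥) → IsFTPForest (P +ᴿ Q)
+ᴿ-FTP {P} {Q} FP FQ apart = record
  { finite      = ∪-finite FP.finite FQ.finite
  ; field-⊆     = λ a b → Sum.[ (λ r → Product.map inj₁ inj₁ (FP.field-⊆ a b r))
                          , (λ r → Product.map inj₂ inj₂ (FQ.field-⊆ a b r)) ]
  ; irreflexive = λ a → Sum.[ FP.irreflexive a , FQ.irreflexive a ]
  ; transitive  = transitive
  ; forest      = forest
  }
  where
  module FP = IsFTPForest FP
  module FQ = IsFTPForest FQ
  PQ = P +ᴿ Q

  transitive : ∀ a b c → R PQ a b → R PQ b c → R PQ a c
  transitive a b c (inj₁ r) (inj₁ r′) = inj₁ (FP.transitive a b c r r′)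
  transitive a b c (inj₂ r) (inj₂ r′) = inj₂ (FQ.transitive a b c r r′)
  transitive a b c (inj₁ r) (inj₂ r′) = ⊥-elim (apart (proj₂ (FP.field-⊆ a b r)) (proj₁ (FQ.field-⊆ b c r′)))
  transitive a b c (inj₂ r) (inj₁ r′) = ⊥-elim (apart (proj₁ (FP.field-⊆ b c r′)) (proj₂ (FQ.field-⊆ a b r)))

  forest : ∀ x y z → X PQ x → X PQ y → X PQ z → R PQ x z → R PQ y z →
           (x ≡ y) ⊎ (R PQ x y ⊎ R PQ y x)
  forest x y z _ _ _ (inj₁ r) (inj₁ r′) =
    Sum.map₂ (Sum.map inj₁ inj₁)
      (FP.forest x y z (proj₁ (FP.field-⊆ x z r)) (proj₁ (FP.field-⊆ y z r′)) (proj₂ (FP.field-⊆ x z r)) r r′)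
  forest x y z _ _ _ (inj₂ r) (inj₂ r′) =
    Sum.map₂ (Sum.map inj₂ inj₂)
      (FQ.forest x y z (proj₁ (FQ.field-⊆ x z r)) (proj₁ (FQ.field-⊆ y z r′)) (proj₂ (FQ.field-⊆ x z r)) r r′)
  forest x y z _ _ _ (inj₁ r) (inj₂ r′) = ⊥-elim (apart (proj₂ (FP.field-⊆ x z r)) (proj₂ (FQ.field-⊆ y z r′)))
  forest x y z _ _ _ (inj₂ r) (inj₁ r′) = ⊥-elim (apart (proj₂ (FP.field-⊆ y z r′)) (proj₂ (FQ.field-⊆ x z r)))

-- Adding a fresh root v below all elements of an FTP-forest P gives an
-- FTP-forest: v is minimal, and the predecessors of any element of P are
-- its predecessors in P together with v, which is below all of them.
root-FTP : ∀ {v P} → IsFTPForest P → ¬ X P v → IsFTPForest (K (var v) ·ᴿ P)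
root-FTP {v} {P} FP v∉P = record
  { finite      = ∪-finite (IsFTPForest.finite (point-FTP v)) FP.finite
  ; field-⊆     = field-⊆
  ; irreflexive = irreflexive
  ; transitive  = transitive
  ; forest      = forest
  }
  where
  module FP = IsFTPForest FP
  T = K (var v) ·ᴿ P

  field-⊆ : ∀ a b → R T a b → X T a × X T b
  field-⊆ a b (inj₁ (inj₂ r))  = Product.map inj₂ inj₂ (FP.field-⊆ a b r)
  field-⊆ a b (inj₂ (a≡v , q)) = inj₁ a≡v , inj₂ q

  irreflexive : ∀ a → ¬ R T a a
  irreflexive a (inj₁ (inj₂ r))  = FP.irreflexive a r
  irreflexive a (inj₂ (refl , q)) = v∉P q

  transitive : ∀ a b c → R T a b → R T b c → R T a c
  transitive a b c (inj₁ (inj₂ r)) (inj₁ (inj₂ r′)) = inj₁ (inj₂ (FP.transitive a b c r r′))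
  transitive a b c (inj₁ (inj₂ r)) (inj₂ (refl , _)) = ⊥-elim (v∉P (proj₂ (FP.field-⊆ a b r)))
  transitive a b c (inj₂ (a≡v , _)) (inj₁ (inj₂ r′)) = inj₂ (a≡v , proj₂ (FP.field-⊆ b c r′))
  transitive a b c (inj₂ (_ , q)) (inj₂ (refl , _))  = ⊥-elim (v∉P q)

  forest : ∀ x y z → X T x → X T y → X T z → R T x z → R T y z →
           (x ≡ y) ⊎ (R T x y ⊎ R T y x)
  forest x y z _ _ _ (inj₁ (inj₂ r)) (inj₁ (inj₂ r′)) =
    Sum.map₂ (Sum.map (λ q → inj₁ (inj₂ q)) (λ q → inj₁ (inj₂ q)))
      (FP.forest x y z (proj₁ (FP.field-⊆ x z r)) (proj₁ (FP.field-⊆ y z r′)) (proj₂ (FP.field-⊆ x z r)) r r′)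
  forest x y z _ _ _ (inj₁ (inj₂ r)) (inj₂ (y≡v , _)) = inj₂ (inj₂ (inj₂ (y≡v , proj₁ (FP.field-⊆ x z r))))
  forest x y z _ _ _ (inj₂ (x≡v , _)) (inj₁ (inj₂ r′)) = inj₂ (inj₁ (inj₂ (x≡v , proj₁ (FP.field-⊆ y z r′))))
  forest x y z _ _ _ (inj₂ (x≡v , _)) (inj₂ (y≡v , _)) = inj₁ (trans x≡v (sym y≡v))

K-FTP : ∀ {t} → InC t → Diversified t → IsFTPForest (K t)
K-FTP (c-var x) _ = point-FTP x
K-FTP (c-plus {t} {s} ct cs) u with Unique-++⁻ (vars t) u
... | ut , us , t#s =
  +ᴿ-FTP (K-FTP ct ut) (K-FTP cs us) (λ p q → t#s (K-domain⊆vars t p , K-domain⊆vars s q))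
K-FTP (c-dot v {t} ct) u with Unique-++⁻ [ v ] u
... | _ , ut , v#t = root-FTP (K-FTP ct ut) (λ p → v#t (here refl , K-domain⊆vars t p))
K-FTP (c-cong ct p) u =
  FTP-resp-≅ (K-resp-≈ p) (K-FTP ct (diversified-resp-≈ (≈-sym p) u))

proposition5p1 : (t : Term) → IsSForest t → IsFTPForest (K t)
proposition5p1 t (t∈C , diversified) = K-FTP t∈C diversified
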